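{- Almost all graphs have infinite multiset dimension: the proportion of labeled graphs on the vertex set $\{1,\dots,n\}$ that are connected and satisfy $md(G)=\infty$ tends to $1$ as $n\to\infty$.
   Context: For vertices $u,v$ of a connected graph $G$, $d(u,v)$ is the length of a shortest $u$–$v$ path. For $W\subseteq V(G)$ and $v\in V(G)$, $r_m(v|W)$ is the multiset $\{d(v,w): w\in W\}$. $W$ is an m-resolving set if $r_m(u|W)\neq r_m(v|W)$ for all distinct $u,v\in V(G)$. If $G$ has an m-resolving set, $md(G)$ is the minimum cardinality of one; otherwise $md(G)=\infty$. -}

module Defs where

open import Data.Nat using (ℕ; zero; suc; _≤_; _*_; _^_)
open import Data.Nat.Combinatorics using (_C_)
open import Data.Fin using (Fin; zero; suc)
open import Data.Bool using (Bool; true; false)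
open import Data.Vec using (Vec; lookup)
open import Data.Unit using (⊤; tt)
open import Data.Product using (_×_; _,_; ∃; Σ)
open import Data.List using (List; length)
open import Data.List.Relation.Unary.All using (All)
open import Data.List.Relation.Unary.Unique.Propositional using (Unique)
open import Data.List.Relation.Binary.Pointwise using (Pointwise)
open import Data.List.Relation.Binary.Permutation.Propositional using (_↭_)
open import Relation.Binary.PropositionalEquality using (_≡_; _≢_)
open import Relation.Nullary using (¬_)

-- A graph on suc n vertices is a graph on the n "old" vertices (suc i)
-- together with the neighbourhood (a Vec Bool n) of the new vertex zero.
-- This is a bijective encoding of all 2^(n choose 2) labeled simple graphs.
Graph : ℕ → Set
Graph zero    = ⊤
Graph (suc n) = Graph n × Vec Bool n

adj : ∀ {n} → Graph n → Fin n → Fin n → Bool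
adj {suc n} (g , e) zero    zero    = false
adj {suc n} (g , e) zero    (suc j) = lookup e j
adj {suc n} (g , e) (suc i) zero    = lookup e i
adj {suc n} (g , e) (suc i) (suc j) = adj g i j

Adj : ∀ {n} → Graph n → Fin n → Fin n → Set
Adj G u v = adj G u v ≡ true

data Walk {n : ℕ} (G : Graph n) : Fin n → Fin n → ℕ → Set where
  here : ∀ {u} → Walk G u u 0
  step : ∀ {u w v k} → Adj G u w → Walk G w v k → Walk G u v (suc k)

Dist : ∀ {n} → Graph n → Fin n → Fin n → ℕ → Set
Dist G u v k = Walk G u v k × (∀ m → Walk G u v m → k ≤ m)

Connected : ∀ {n} → Graph n → Set
Connected G = ∀ u v → ∃ λ k → Walk G u v k

-- A subset W of V(G) is given as a duplicate-free list of vertices.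
-- RM G v W ds : ds lists d(v,w) for the w ∈ W (in order), so the
-- multiset r_m(v|W) is ds up to permutation.
RM : ∀ {n} → Graph n → Fin n → List (Fin n) → List ℕ → Set
RM G v W ds = Pointwise (λ w k → Dist G v w k) W ds

MResolving : ∀ {n} → Graph n → List (Fin n) → Set
MResolving G W = ∀ u v → u ≢ v → ∀ ds ds' → RM G u W ds → RM G v W ds' → ¬ (ds ↭ ds')

MdInfinite : ∀ {n} → Graph n → Set
MdInfinite {n} G = ∀ (W : List (Fin n)) → Unique W → ¬ MResolving G W

numGraphs : ℕ → ℕ
numGraphs n = 2 ^ (n C 2)

module Submission where

-- Call an ordered pair of distinct vertices *far* if they are non-adjacent and
-- have no common neighbour.  A graph without far pairs has diameter at most two,
-- so it is connected and every distance lies in {0,1,2}; the multiset r_m(v|W)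
-- is then determined by the two numbers [v ∈ W] and |N(v) ∩ W|.  For every W some
-- two distinct vertices agree on both numbers (for |W| ≥ 2 this is the classical
-- fact that two vertices of G[W] have equal degree), so no W is m-resolving and
-- md(G) = ∞, as soon as G has at least four vertices.
--
-- A graph on n+1 vertices is a graph on n vertices plus the
-- neighbourhood vector of the new vertex; summing over that vector yields exact
-- recurrences for the total number of far pairs over all graphs, coupled with the
-- auxiliary weight Σ_v 2^(number of non-neighbours of v).  Solving them bounds the
-- average number of far pairs by (8/9)·n²·(3/4)ⁿ ≤ 512/(9n) for n ≥ 10, and by
-- Markov's inequality at most a fraction 1/(k+1) of all graphs have a far pair as
-- soon as n ≥ 57(k+1)+10.

open import Defs
open import Data.Nat using (ℕ; zero; suc; pred; _≤_; _<_; _*_; _+_; _^_; z≤n; s≤s; _≡ᵇ_; _≤?_; ≢-nonZero)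
open import Data.Nat.Properties
open import Algebra.Properties.CommutativeSemigroup +-commutativeSemigroup
  using () renaming (interchange to +-interchange)
open import Data.Nat.Combinatorics using (_C_; nCk+nC[k+1]≡[n+1]C[k+1]; nC1≡n)
open import Data.Nat.Tactic.RingSolver using (solve-∀)
open import Data.Bool using (Bool; true; false; _∧_; _∨_; not; T)
open import Data.Bool.Properties
  using (T?; not-injective; ∨-zeroʳ; ∨-identityʳ; ∧-zeroʳ; ∧-identityʳ; ∧-comm; ∧-distribˡ-∨)
open import Data.Fin using (Fin; zero; suc; toℕ; fromℕ<)
import Data.Fin.Properties as FinP
open import Data.Vec using (Vec; []; _∷_; lookup)
import Data.Vec.Properties as VecP
open import Data.List
  using (List; []; _∷_; length; map; _++_; replicate; filter; cartesianProduct; cartesianProductWith)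
import Data.List as List
open import Data.List.Properties using (length-map)
open import Data.List.Relation.Unary.All using (All; []; _∷_)
import Data.List.Relation.Unary.All as All
open import Data.List.Relation.Unary.All.Properties using (all-filter; map⁺)
open import Data.List.Relation.Unary.Any using (here; there)
open import Data.List.Relation.Unary.AllPairs using ([]; _∷_)
open import Data.List.Relation.Unary.Unique.Propositional using (Unique)
open import Data.List.Relation.Unary.Unique.Propositional.Properties
  using (filter⁺; cartesianProduct⁺; cartesianProductWith⁺)
open import Data.List.Membership.Propositional using (_∈_)
open import Data.List.Membership.Propositional.Properties using (∈-lookup)
open import Data.List.Relation.Binary.Pointwise using ([]; _∷_)
open import Data.List.Relation.Binary.Permutation.Propositional
  using (_↭_; prep; ↭-refl; ↭-sym; ↭-trans; module PermutationReasoning)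
open import Data.List.Relation.Binary.Permutation.Propositional.Properties using (shift; ++⁺ˡ)
open import Data.Product using (Σ; ∃; _×_; _,_; proj₁)
open import Data.Unit using (tt)
open import Data.Empty using (⊥-elim)
open import Relation.Nullary using (¬_; yes; no)
open import Relation.Nullary.Decidable using (toWitness)
open import Function using (_∘_)
open import Relation.Binary.PropositionalEquality

⟦_⟧ : Bool → ℕ
⟦ true ⟧  = 1
⟦ false ⟧ = 0

⟦⟧≤1 : ∀ b → ⟦ b ⟧ ≤ 1
⟦⟧≤1 true  = s≤s z≤n
⟦⟧≤1 false = z≤n

ΣL : {A : Set} → (A → ℕ) → List A → ℕ
ΣL f []       = 0
ΣL f (x ∷ xs) = f x + ΣL f xs

module _ {A : Set} where

  ΣL-cong : ∀ {f g : A → ℕ} → (∀ x → f x ≡ g x) → ∀ xs → ΣL f xs ≡ ΣL g xs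
  ΣL-cong f≡g []       = refl
  ΣL-cong f≡g (x ∷ xs) = cong₂ _+_ (f≡g x) (ΣL-cong f≡g xs)

  ΣL-zero : ∀ xs → ΣL (λ (_ : A) → 0) xs ≡ 0
  ΣL-zero []       = refl
  ΣL-zero (x ∷ xs) = ΣL-zero xs

  ΣL-+ : ∀ (f g : A → ℕ) xs → ΣL (λ x → f x + g x) xs ≡ ΣL f xs + ΣL g xs
  ΣL-+ f g []       = refl
  ΣL-+ f g (x ∷ xs) = trans (cong (f x + g x +_) (ΣL-+ f g xs)) (+-interchange (f x) (g x) _ _)

  ΣL-* : ∀ c (f : A → ℕ) xs → ΣL (λ x → c * f x) xs ≡ c * ΣL f xs
  ΣL-* c f []       = sym (*-zeroʳ c)
  ΣL-* c f (x ∷ xs) = trans (cong (c * f x +_) (ΣL-* c f xs)) (sym (*-distribˡ-+ c (f x) _))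

  ΣL-++ : ∀ (f : A → ℕ) xs ys → ΣL f (xs ++ ys) ≡ ΣL f xs + ΣL f ys
  ΣL-++ f []       ys = refl
  ΣL-++ f (x ∷ xs) ys = trans (cong (f x +_) (ΣL-++ f xs ys)) (sym (+-assoc (f x) _ _))

ΣL-map : ∀ {A B : Set} (f : B → ℕ) (g : A → B) xs → ΣL f (map g xs) ≡ ΣL (f ∘ g) xs
ΣL-map f g []       = refl
ΣL-map f g (x ∷ xs) = cong (f (g x) +_) (ΣL-map f g xs)

ΣL-cartesian : ∀ {A B C : Set} (f : C → ℕ) (h : A → B → C) xs ys →
  ΣL f (cartesianProductWith h xs ys) ≡ ΣL (λ x → ΣL (λ y → f (h x y)) ys) xs
ΣL-cartesian f h []       ys = refl
ΣL-cartesian f h (x ∷ xs) ys = trans (ΣL-++ f (map (h x) ys) _)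
  (cong₂ _+_ (ΣL-map f (h x) ys) (ΣL-cartesian f h xs ys))

ΣF : ∀ {n} → (Fin n → ℕ) → ℕ
ΣF {zero}  f = 0
ΣF {suc n} f = f zero + ΣF (f ∘ suc)

anyF : ∀ {n} → (Fin n → Bool) → Bool
anyF {zero}  f = false
anyF {suc n} f = f zero ∨ anyF (f ∘ suc)

eqF : ∀ {n} → Fin n → Fin n → Bool
eqF zero    zero    = true
eqF zero    (suc j) = false
eqF (suc i) zero    = false
eqF (suc i) (suc j) = eqF i j

eqF-refl : ∀ {n} (i : Fin n) → eqF i i ≡ true
eqF-refl zero    = refl
eqF-refl (suc i) = eqF-refl i

eqF-true : ∀ {n} (i j : Fin n) → eqF i j ≡ true → i ≡ j
eqF-true zero    zero    _ = refl
eqF-true (suc i) (suc j) e = cong suc (eqF-true i j e)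

ΣF-cong : ∀ {n} {f g : Fin n → ℕ} → (∀ i → f i ≡ g i) → ΣF f ≡ ΣF g
ΣF-cong {zero}  f≡g = refl
ΣF-cong {suc n} f≡g = cong₂ _+_ (f≡g zero) (ΣF-cong (f≡g ∘ suc))

ΣF-+ : ∀ {n} (f g : Fin n → ℕ) → ΣF (λ i → f i + g i) ≡ ΣF f + ΣF g
ΣF-+ {zero}  f g = refl
ΣF-+ {suc n} f g =
  trans (cong (f zero + g zero +_) (ΣF-+ (f ∘ suc) (g ∘ suc))) (+-interchange (f zero) (g zero) _ _)

ΣF-* : ∀ {n} c (f : Fin n → ℕ) → ΣF (λ i → c * f i) ≡ c * ΣF f
ΣF-* {zero}  c f = sym (*-zeroʳ c)
ΣF-* {suc n} c f = trans (cong (c * f zero +_) (ΣF-* c (f ∘ suc))) (sym (*-distribˡ-+ c (f zero) _))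

ΣF-zero : ∀ {n} (f : Fin n → ℕ) → ΣF f ≡ 0 → ∀ i → f i ≡ 0
ΣF-zero {suc n} f e zero    = m+n≡0⇒m≡0 (f zero) e
ΣF-zero {suc n} f e (suc i) = ΣF-zero (f ∘ suc) (m+n≡0⇒n≡0 (f zero) e) i

ΣL-ΣF : ∀ {A : Set} {n} (f : A → Fin n → ℕ) xs →
  ΣL (λ x → ΣF (f x)) xs ≡ ΣF (λ i → ΣL (λ x → f x i) xs)
ΣL-ΣF {n = zero}  f xs = ΣL-zero xs
ΣL-ΣF {n = suc n} f xs = trans (ΣL-+ (λ x → f x zero) (λ x → ΣF (f x ∘ suc)) xs)
  (cong (ΣL (λ x → f x zero) xs +_) (ΣL-ΣF (λ x → f x ∘ suc) xs))

anyF-true : ∀ {n} (f : Fin n → Bool) → anyF f ≡ true → ∃ λ i → f i ≡ true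
anyF-true {suc n} f e with f zero in e0
... | true  = zero , e0
... | false with anyF-true (f ∘ suc) e
...   | i , p = suc i , p

anyF-cong : ∀ {n} {f g : Fin n → Bool} → (∀ i → f i ≡ g i) → anyF f ≡ anyF g
anyF-cong {zero}  f≡g = refl
anyF-cong {suc n} f≡g = cong₂ _∨_ (f≡g zero) (anyF-cong (f≡g ∘ suc))

anyF-∨ : ∀ {n} (f g : Fin n → Bool) → anyF (λ i → f i ∨ g i) ≡ anyF f ∨ anyF g
anyF-∨ {zero}  f g = refl
anyF-∨ {suc n} f g = trans (cong ((f zero ∨ g zero) ∨_) (anyF-∨ (f ∘ suc) (g ∘ suc)))
                           (∨-interchange (f zero) (g zero) _ _)
  where
  ∨-interchange : ∀ a b c d → (a ∨ b) ∨ (c ∨ d) ≡ (a ∨ c) ∨ (b ∨ d)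
  ∨-interchange true  b     c d = refl
  ∨-interchange false true  c d = sym (∨-zeroʳ c)
  ∨-interchange false false c d = refl

anyF-false : ∀ n → anyF {n} (λ _ → false) ≡ false
anyF-false zero    = refl
anyF-false (suc n) = anyF-false n

anyF-singleton : ∀ {n} (e : Vec Bool n) (j : Fin n) → anyF (λ w → lookup e w ∧ eqF j w) ≡ lookup e j
anyF-singleton {suc n} (b ∷ e) zero = begin
    b ∧ true ∨ anyF (λ w → lookup e w ∧ false)
  ≡⟨ cong₂ _∨_ (∧-identityʳ b) (anyF-cong (λ w → ∧-zeroʳ (lookup e w))) ⟩
    b ∨ anyF {n} (λ _ → false)
  ≡⟨ cong (b ∨_) (anyF-false n) ⟩
    b ∨ false
  ≡⟨ ∨-identityʳ b ⟩
    b ∎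
  where open ≡-Reasoning
anyF-singleton (b ∷ e) (suc j) =
  trans (cong (_∨ anyF (λ w → lookup e w ∧ eqF j w)) (∧-zeroʳ b)) (anyF-singleton e j)

allVecs : ∀ n → List (Vec Bool n)
allVecs zero    = [] ∷ []
allVecs (suc n) = cartesianProductWith _∷_ (false ∷ true ∷ []) (allVecs n)

allVecs-unique : ∀ n → Unique (allVecs n)
allVecs-unique zero    = [] ∷ []
allVecs-unique (suc n) = cartesianProductWith⁺ _∷_ (λ e → VecP.∷-injectiveˡ e , VecP.∷-injectiveʳ e)
  (((λ ()) ∷ []) ∷ [] ∷ []) (allVecs-unique n)

ΣV-step : ∀ n (f : Vec Bool (suc n) → ℕ) → ΣL f (allVecs (suc n)) ≡
  ΣL (λ e → f (false ∷ e)) (allVecs n) + ΣL (λ e → f (true ∷ e)) (allVecs n)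
ΣV-step n f = trans (ΣL-cartesian f _∷_ (false ∷ true ∷ []) (allVecs n))
  (cong (ΣL (λ e → f (false ∷ e)) (allVecs n) +_) (+-identityʳ _))

twice : ∀ a → a + a ≡ 2 * a
twice a = cong (a +_) (sym (+-identityʳ a))

count-allVecs : ∀ n → ΣL (λ _ → 1) (allVecs n) ≡ 2 ^ n
count-allVecs zero    = refl
count-allVecs (suc n) = trans (ΣV-step n (λ _ → 1))
  (trans (cong₂ _+_ (count-allVecs n) (count-allVecs n)) (twice (2 ^ n)))

count-avoid₁ : ∀ n (j : Fin n) → 2 * ΣL (λ e → ⟦ not (lookup e j) ⟧) (allVecs n) ≡ 2 ^ n
count-avoid₁ (suc n) zero = begin
    2 * ΣL (λ e → ⟦ not (lookup e zero) ⟧) (allVecs (suc n))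
  ≡⟨ cong (2 *_) (ΣV-step n _) ⟩
    2 * (ΣL (λ _ → 1) (allVecs n) + ΣL (λ _ → 0) (allVecs n))
  ≡⟨ cong₂ (λ a b → 2 * (a + b)) (count-allVecs n) (ΣL-zero (allVecs n)) ⟩
    2 * (2 ^ n + 0)
  ≡⟨ cong (2 *_) (+-identityʳ (2 ^ n)) ⟩
    2 ^ suc n ∎
  where open ≡-Reasoning
count-avoid₁ (suc n) (suc j) = begin
    2 * ΣL (λ e → ⟦ not (lookup e (suc j)) ⟧) (allVecs (suc n))
  ≡⟨ cong (2 *_) (ΣV-step n _) ⟩
    2 * (A + A)
  ≡⟨ cong (2 *_) (twice A) ⟩
    2 * (2 * A)
  ≡⟨ cong (2 *_) (count-avoid₁ n j) ⟩
    2 ^ suc n ∎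
  where open ≡-Reasoning
        A = ΣL (λ e → ⟦ not (lookup e j) ⟧) (allVecs n)

-- If half of the vectors of length n avoid a coordinate, then three quarters of
-- the vectors of length n+1 avoid that coordinate or the new first one.
three-quarters : ∀ x b → 2 * b ≡ x → 4 * (x + b) ≡ 3 * (2 * x)
three-quarters x b refl = lemma b
  where lemma : ∀ b → 4 * (2 * b + b) ≡ 3 * (2 * (2 * b))
        lemma = solve-∀

count-avoid₂ : ∀ n (i j : Fin n) → i ≢ j →
  4 * ΣL (λ e → ⟦ not (lookup e i ∧ lookup e j) ⟧) (allVecs n) ≡ 3 * 2 ^ n
count-avoid₂ (suc n) zero zero i≢j = ⊥-elim (i≢j refl)
count-avoid₂ (suc n) zero (suc j) _ = begin
    4 * ΣL (λ e → ⟦ not (lookup e zero ∧ lookup e (suc j)) ⟧) (allVecs (suc n))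
  ≡⟨ cong (4 *_) (ΣV-step n _) ⟩
    4 * (ΣL (λ _ → 1) (allVecs n) + B)
  ≡⟨ cong (λ x → 4 * (x + B)) (count-allVecs n) ⟩
    4 * (2 ^ n + B)
  ≡⟨ three-quarters (2 ^ n) B (count-avoid₁ n j) ⟩
    3 * 2 ^ suc n ∎
  where open ≡-Reasoning
        B = ΣL (λ e → ⟦ not (lookup e j) ⟧) (allVecs n)
count-avoid₂ (suc n) (suc i) zero i≢j = begin
    4 * ΣL (λ e → ⟦ not (lookup e (suc i) ∧ lookup e zero) ⟧) (allVecs (suc n))
  ≡⟨ cong (4 *_) (ΣL-cong (λ e → cong (⟦_⟧ ∘ not) (∧-comm (lookup e (suc i)) (lookup e zero)))
                          (allVecs (suc n))) ⟩
    4 * ΣL (λ e → ⟦ not (lookup e zero ∧ lookup e (suc i)) ⟧) (allVecs (suc n))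
  ≡⟨ count-avoid₂ (suc n) zero (suc i) (λ ()) ⟩
    3 * 2 ^ suc n ∎
  where open ≡-Reasoning
count-avoid₂ (suc n) (suc i) (suc j) i≢j = begin
    4 * ΣL (λ e → ⟦ not (lookup e (suc i) ∧ lookup e (suc j)) ⟧) (allVecs (suc n))
  ≡⟨ cong (4 *_) (ΣV-step n _) ⟩
    4 * (A + A)
  ≡⟨ double 4 A ⟩
    2 * (4 * A)
  ≡⟨ cong (2 *_) (count-avoid₂ n i j (i≢j ∘ cong suc)) ⟩
    2 * (3 * 2 ^ n)
  ≡⟨ *-swap 2 3 (2 ^ n) ⟩
    3 * 2 ^ suc n ∎
  where open ≡-Reasoning
        A = ΣL (λ e → ⟦ not (lookup e i ∧ lookup e j) ⟧) (allVecs n)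
        double : ∀ c a → c * (a + a) ≡ 2 * (c * a)
        double = solve-∀
        *-swap : ∀ a b c → a * (b * c) ≡ b * (a * c)
        *-swap = solve-∀

-- Vectors disjoint from a set m: they are free exactly on the complement of m.
count-disjoint : ∀ n (m : Fin n → Bool) →
  ΣL (λ e → ⟦ not (anyF (λ w → lookup e w ∧ m w)) ⟧) (allVecs n) ≡ 2 ^ ΣF (λ w → ⟦ not (m w) ⟧)
count-disjoint zero    m = refl
count-disjoint (suc n) m = trans (ΣV-step n _) (by-first (m zero) refl)
  where
  free = ΣL (λ e → ⟦ not (anyF (λ w → lookup e w ∧ m (suc w))) ⟧) (allVecs n)
  rest : free ≡ 2 ^ ΣF (λ w → ⟦ not (m (suc w)) ⟧)
  rest = count-disjoint n (m ∘ suc)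
  by-first : ∀ b → m zero ≡ b →
    free + ΣL (λ e → ⟦ not (m zero ∨ anyF (λ w → lookup e w ∧ m (suc w))) ⟧) (allVecs n)
      ≡ 2 ^ ΣF (λ w → ⟦ not (m w) ⟧)
  by-first true  m₀ rewrite m₀ = trans (cong (free +_) (ΣL-zero (allVecs n))) (trans (+-identityʳ free) rest)
  by-first false m₀ rewrite m₀ = trans (cong₂ _+_ rest rest) (twice (2 ^ ΣF (λ w → ⟦ not (m (suc w)) ⟧)))

-- Σ_e 2^(number of zeros of e) = 3ⁿ: each coordinate contributes 1 + 2.
Σ-2^zeros : ∀ n → ΣL (λ e → 2 ^ ΣF (λ w → ⟦ not (lookup e w) ⟧)) (allVecs n) ≡ 3 ^ n
Σ-2^zeros zero    = refl
Σ-2^zeros (suc n) = begin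
    ΣL (λ e → 2 ^ ΣF (λ w → ⟦ not (lookup e w) ⟧)) (allVecs (suc n))
  ≡⟨ ΣV-step n _ ⟩
    ΣL (λ e → 2 * f e) (allVecs n) + ΣL f (allVecs n)
  ≡⟨ cong (_+ ΣL f (allVecs n)) (ΣL-* 2 f (allVecs n)) ⟩
    2 * ΣL f (allVecs n) + ΣL f (allVecs n)
  ≡⟨ cong (λ x → 2 * x + x) (Σ-2^zeros n) ⟩
    2 * 3 ^ n + 3 ^ n
  ≡⟨ +-comm (2 * 3 ^ n) (3 ^ n) ⟩
    3 ^ suc n ∎
  where open ≡-Reasoning
        f : Vec Bool n → ℕ
        f e = 2 ^ ΣF (λ w → ⟦ not (lookup e w) ⟧)

Σ-2^avoid₁ : ∀ n (j : Fin n) c →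
  2 * ΣL (λ e → 2 ^ (⟦ not (lookup e j) ⟧ + c)) (allVecs n) ≡ 3 * 2 ^ n * 2 ^ c
Σ-2^avoid₁ n j c = begin
    2 * ΣL (λ e → 2 ^ (⟦ not (lookup e j) ⟧ + c)) (allVecs n)
  ≡⟨ cong (2 *_) (ΣL-cong (λ e → split (lookup e j)) (allVecs n)) ⟩
    2 * ΣL (λ e → 2 ^ c * (1 + ⟦ not (lookup e j) ⟧)) (allVecs n)
  ≡⟨ cong (2 *_) (ΣL-* (2 ^ c) _ (allVecs n)) ⟩
    2 * (2 ^ c * ΣL (λ e → 1 + ⟦ not (lookup e j) ⟧) (allVecs n))
  ≡⟨ cong (λ x → 2 * (2 ^ c * x)) (ΣL-+ (λ _ → 1) _ (allVecs n)) ⟩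
    2 * (2 ^ c * (ΣL (λ _ → 1) (allVecs n) + B))
  ≡⟨ cong (λ x → 2 * (2 ^ c * (x + B))) (count-allVecs n) ⟩
    2 * (2 ^ c * (2 ^ n + B))
  ≡⟨ finish (2 ^ c) (2 ^ n) (count-avoid₁ n j) ⟩
    3 * 2 ^ n * 2 ^ c ∎
  where
  open ≡-Reasoning
  B = ΣL (λ e → ⟦ not (lookup e j) ⟧) (allVecs n)
  split : ∀ b → 2 ^ (⟦ not b ⟧ + c) ≡ 2 ^ c * (1 + ⟦ not b ⟧)
  split true  = sym (*-identityʳ _)
  split false = *-comm 2 (2 ^ c)
  finish : ∀ x y → 2 * B ≡ y → 2 * (x * (y + B)) ≡ 3 * y * x
  finish x y refl = lemma x B
    where lemma : ∀ x b → 2 * (x * (2 * b + b)) ≡ 3 * (2 * b) * x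
          lemma = solve-∀

adj-irrefl : ∀ {n} (G : Graph n) i → adj G i i ≡ false
adj-irrefl {suc n} (g , e) zero    = refl
adj-irrefl {suc n} (g , e) (suc i) = adj-irrefl g i

adj-sym : ∀ {n} (G : Graph n) i j → adj G i j ≡ adj G j i
adj-sym {suc n} (g , e) zero    zero    = refl
adj-sym {suc n} (g , e) zero    (suc j) = refl
adj-sym {suc n} (g , e) (suc i) zero    = refl
adj-sym {suc n} (g , e) (suc i) (suc j) = adj-sym g i j

commonNbr : ∀ {n} → Graph n → Fin n → Fin n → Bool
commonNbr G i j = anyF (λ w → adj G i w ∧ adj G w j)

-- (i , j) is a far pair: distinct, non-adjacent and without common neighbour,
-- i.e. d(i,j) > 2.
far : ∀ {n} → Graph n → Fin n → Fin n → Bool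
far G i j = not (eqF i j) ∧ (not (adj G i j) ∧ not (commonNbr G i j))

far-irrefl : ∀ {n} (G : Graph n) i → far G i i ≡ false
far-irrefl G i rewrite eqF-refl i = refl

farPairs : ∀ {n} → Graph n → ℕ
farPairs G = ΣF (λ i → ΣF (λ j → ⟦ far G i j ⟧))

nonNbrs : ∀ {n} → Graph n → Fin n → ℕ
nonNbrs G i = ΣF (λ w → ⟦ not (eqF i w ∨ adj G i w) ⟧)

-- Σ_i 2^(nonNbrs G i): summed over all neighbourhoods of a new vertex, this
-- counts the far pairs that the new vertex forms.
weight : ∀ {n} → Graph n → ℕ
weight G = ΣF (λ i → 2 ^ nonNbrs G i)

-- After adding a new vertex with neighbourhood e, the pair (new vertex, j) is far
-- iff j ∉ e and no neighbour of j lies in e.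
farFromNew : ∀ {n} → Graph n → Vec Bool n → Fin n → Bool
farFromNew g e j = not (lookup e j) ∧ not (anyF (λ w → lookup e w ∧ adj g w j))

far-new : ∀ {n} (g : Graph n) e i → far {suc n} (g , e) (suc i) zero ≡ farFromNew g e i
far-new g e i = cong (λ z → not (lookup e i) ∧ not z)
  (trans (cong (_∨ anyF (λ w → adj g i w ∧ lookup e w)) (∧-zeroʳ (lookup e i)))
         (anyF-cong (λ w → trans (cong (_∧ lookup e w) (adj-sym g i w)) (∧-comm (adj g w i) (lookup e w)))))

far-old : ∀ {n} (g : Graph n) e i j →
  far {suc n} (g , e) (suc i) (suc j) ≡ far g i j ∧ not (lookup e i ∧ lookup e j)
far-old g e i j = truth-table (eqF i j) (adj g i j) (commonNbr g i j) (lookup e i ∧ lookup e j)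
  where
  truth-table : ∀ a b c d → not a ∧ (not b ∧ not (d ∨ c)) ≡ (not a ∧ (not b ∧ not c)) ∧ not d
  truth-table true  b     c     d     = refl
  truth-table false true  c     d     = refl
  truth-table false false true  true  = refl
  truth-table false false true  false = refl
  truth-table false false false true  = refl
  truth-table false false false false = refl

stillFar : ∀ {n} → Graph n → Vec Bool n → Fin n → Fin n → ℕ
stillFar g e i j = ⟦ far g i j ∧ not (lookup e i ∧ lookup e j) ⟧

farPairs-extend : ∀ {n} (g : Graph n) e → farPairs {suc n} (g , e) ≡
  ΣF (λ i → ⟦ farFromNew g e i ⟧ + (⟦ farFromNew g e i ⟧ + ΣF (stillFar g e i)))
farPairs-extend g e = trans
  (cong (ΣF (λ i → ⟦ farFromNew g e i ⟧) +_)
    (ΣF-cong (λ i → cong₂ _+_ (cong ⟦_⟧ (far-new g e i)) (ΣF-cong (λ j → cong ⟦_⟧ (far-old g e i j))))))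
  (sym (ΣF-+ (λ i → ⟦ farFromNew g e i ⟧) _))

farFromNew-disjoint : ∀ {n} (g : Graph n) e j →
  farFromNew g e j ≡ not (anyF (λ w → lookup e w ∧ (eqF j w ∨ adj g j w)))
farFromNew-disjoint g e j = sym (begin
    not (anyF (λ w → lookup e w ∧ (eqF j w ∨ adj g j w)))
  ≡⟨ cong not (anyF-cong (λ w → trans (∧-distribˡ-∨ (lookup e w) _ _)
       (cong (λ z → (lookup e w ∧ eqF j w) ∨ (lookup e w ∧ z)) (adj-sym g j w)))) ⟩
    not (anyF (λ w → (lookup e w ∧ eqF j w) ∨ (lookup e w ∧ adj g w j)))
  ≡⟨ cong not (anyF-∨ (λ w → lookup e w ∧ eqF j w) (λ w → lookup e w ∧ adj g w j)) ⟩
    not (anyF (λ w → lookup e w ∧ eqF j w) ∨ anyF (λ w → lookup e w ∧ adj g w j))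
  ≡⟨ cong (λ z → not (z ∨ anyF (λ w → lookup e w ∧ adj g w j))) (anyF-singleton e j) ⟩
    not (lookup e j ∨ anyF (λ w → lookup e w ∧ adj g w j))
  ≡⟨ not-∨ (lookup e j) _ ⟩
    farFromNew g e j ∎)
  where
  open ≡-Reasoning
  not-∨ : ∀ a b → not (a ∨ b) ≡ not a ∧ not b
  not-∨ true  b = refl
  not-∨ false b = refl

count-farFromNew : ∀ {n} (g : Graph n) j → ΣL (λ e → ⟦ farFromNew g e j ⟧) (allVecs n) ≡ 2 ^ nonNbrs g j
count-farFromNew {n} g j = trans (ΣL-cong (λ e → cong ⟦_⟧ (farFromNew-disjoint g e j)) (allVecs n))
  (count-disjoint n (λ w → eqF j w ∨ adj g j w))

count-stillFar : ∀ {n} (g : Graph n) i j →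
  4 * ΣL (λ e → stillFar g e i j) (allVecs n) ≡ 3 * 2 ^ n * ⟦ far g i j ⟧
count-stillFar {n} g i j with far g i j in isFar
... | false = trans (cong (4 *_) (ΣL-zero (allVecs n))) (sym (*-zeroʳ (3 * 2 ^ n)))
... | true  = trans (count-avoid₂ n i j i≢j) (sym (*-identityʳ _))
  where
  i≢j : i ≢ j
  i≢j refl with () ← trans (sym isFar) (far-irrefl g i)

module Extension {n} (g : Graph n) where

  farAt : Vec Bool n → Fin n → ℕ
  farAt e i = ⟦ farFromNew g e i ⟧ + (⟦ farFromNew g e i ⟧ + ΣF (stillFar g e i))

  Σ-farAt : ∀ i → 4 * ΣL (λ e → farAt e i) (allVecs n) ≡
    8 * 2 ^ nonNbrs g i + ΣF (λ j → 3 * 2 ^ n * ⟦ far g i j ⟧)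
  Σ-farAt i = begin
      4 * ΣL (λ e → farAt e i) (allVecs n)
    ≡⟨ cong (4 *_) (trans (ΣL-+ (λ e → ⟦ farFromNew g e i ⟧) _ (allVecs n))
                          (cong (N +_) (ΣL-+ (λ e → ⟦ farFromNew g e i ⟧) _ (allVecs n)))) ⟩
      4 * (N + (N + ΣL (λ e → ΣF (stillFar g e i)) (allVecs n)))
    ≡⟨ cong₂ (λ a s → 4 * (a + (a + s))) (count-farFromNew g i) (ΣL-ΣF (λ e → stillFar g e i) (allVecs n)) ⟩
      4 * (2 ^ nonNbrs g i + (2 ^ nonNbrs g i + ΣF (λ j → ΣL (λ e → stillFar g e i j) (allVecs n))))
    ≡⟨ regroup (2 ^ nonNbrs g i) _ ⟩
      8 * 2 ^ nonNbrs g i + 4 * ΣF (λ j → ΣL (λ e → stillFar g e i j) (allVecs n))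
    ≡⟨ cong (8 * 2 ^ nonNbrs g i +_) (trans (sym (ΣF-* {n} 4 _)) (ΣF-cong (count-stillFar g i))) ⟩
      8 * 2 ^ nonNbrs g i + ΣF (λ j → 3 * 2 ^ n * ⟦ far g i j ⟧) ∎
    where
    open ≡-Reasoning
    N = ΣL (λ e → ⟦ farFromNew g e i ⟧) (allVecs n)
    regroup : ∀ a s → 4 * (a + (a + s)) ≡ 8 * a + 4 * s
    regroup = solve-∀

  Σ-farPairs : 4 * ΣL (λ e → farPairs {suc n} (g , e)) (allVecs n) ≡ 8 * weight g + 3 * 2 ^ n * farPairs g
  Σ-farPairs = begin
      4 * ΣL (λ e → farPairs {suc n} (g , e)) (allVecs n)
    ≡⟨ cong (4 *_) (trans (ΣL-cong (farPairs-extend g) (allVecs n)) (ΣL-ΣF farAt (allVecs n))) ⟩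
      4 * ΣF (λ i → ΣL (λ e → farAt e i) (allVecs n))
    ≡⟨ trans (sym (ΣF-* {n} 4 _)) (ΣF-cong Σ-farAt) ⟩
      ΣF (λ i → 8 * 2 ^ nonNbrs g i + ΣF (λ j → 3 * 2 ^ n * ⟦ far g i j ⟧))
    ≡⟨ ΣF-+ (λ i → 8 * 2 ^ nonNbrs g i) (λ i → ΣF (λ j → 3 * 2 ^ n * ⟦ far g i j ⟧)) ⟩
      ΣF (λ i → 8 * 2 ^ nonNbrs g i) + ΣF (λ i → ΣF (λ j → 3 * 2 ^ n * ⟦ far g i j ⟧))
    ≡⟨ cong₂ _+_ (ΣF-* 8 (λ i → 2 ^ nonNbrs g i))
                 (trans (ΣF-cong (λ i → ΣF-* (3 * 2 ^ n) (λ j → ⟦ far g i j ⟧)))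
                        (ΣF-* (3 * 2 ^ n) (λ i → ΣF (λ j → ⟦ far g i j ⟧)))) ⟩
      8 * weight g + 3 * 2 ^ n * farPairs g ∎
    where open ≡-Reasoning

  -- The new vertex contributes 2^(zeros of e); old vertex i gains a
  -- non-neighbour exactly when i ∉ e.
  Σ-weight : 2 * ΣL (λ e → weight {suc n} (g , e)) (allVecs n) ≡ 2 * 3 ^ n + 3 * 2 ^ n * weight g
  Σ-weight = begin
      2 * ΣL (λ e → weight {suc n} (g , e)) (allVecs n)
    ≡⟨ cong (2 *_) (ΣL-+ (λ e → 2 ^ ΣF (λ w → ⟦ not (lookup e w) ⟧)) _ (allVecs n)) ⟩
      2 * (ΣL (λ e → 2 ^ ΣF (λ w → ⟦ not (lookup e w) ⟧)) (allVecs n) + ΣL (λ e → ΣF (old e)) (allVecs n))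
    ≡⟨ cong₂ (λ a b → 2 * (a + b)) (Σ-2^zeros n) (ΣL-ΣF old (allVecs n)) ⟩
      2 * (3 ^ n + ΣF (λ i → ΣL (λ e → old e i) (allVecs n)))
    ≡⟨ trans (*-distribˡ-+ 2 (3 ^ n) _) (cong (2 * 3 ^ n +_) (sym (ΣF-* {n} 2 _))) ⟩
      2 * 3 ^ n + ΣF (λ i → 2 * ΣL (λ e → old e i) (allVecs n))
    ≡⟨ cong (2 * 3 ^ n +_) (trans (ΣF-cong (λ i → Σ-2^avoid₁ n i (nonNbrs g i)))
                                  (ΣF-* (3 * 2 ^ n) (λ i → 2 ^ nonNbrs g i))) ⟩
      2 * 3 ^ n + 3 * 2 ^ n * weight g ∎
    where
    open ≡-Reasoning
    old : Vec Bool n → Fin n → ℕ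
    old e i = 2 ^ (⟦ not (lookup e i) ⟧ + nonNbrs g i)

allGraphs : ∀ n → List (Graph n)
allGraphs zero    = tt ∷ []
allGraphs (suc n) = cartesianProduct (allGraphs n) (allVecs n)

allGraphs-unique : ∀ n → Unique (allGraphs n)
allGraphs-unique zero    = [] ∷ []
allGraphs-unique (suc n) = cartesianProduct⁺ (allGraphs-unique n) (allVecs-unique n)

ΣG-step : ∀ n (f : Graph (suc n) → ℕ) →
  ΣL f (allGraphs (suc n)) ≡ ΣL (λ g → ΣL (λ e → f (g , e)) (allVecs n)) (allGraphs n)
ΣG-step n f = ΣL-cartesian f _,_ (allGraphs n) (allVecs n)

total totalFar totalWeight : ℕ → ℕ
total       n = ΣL (λ _ → 1) (allGraphs n)
totalFar    n = ΣL farPairs (allGraphs n)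
totalWeight n = ΣL weight (allGraphs n)

total-step : ∀ n → total (suc n) ≡ 2 ^ n * total n
total-step n = trans (ΣG-step n (λ _ → 1))
  (trans (ΣL-cong (λ g → trans (count-allVecs n) (sym (*-identityʳ (2 ^ n)))) (allGraphs n))
         (ΣL-* (2 ^ n) (λ _ → 1) (allGraphs n)))

-- Hence there are 2^(n choose 2) graphs, using n C 1 + n C 2 = (n+1) C 2.
total≡numGraphs : ∀ n → total n ≡ numGraphs n
total≡numGraphs zero    = refl
total≡numGraphs (suc n) = begin
    total (suc n)
  ≡⟨ total-step n ⟩
    2 ^ n * total n
  ≡⟨ cong (2 ^ n *_) (total≡numGraphs n) ⟩
    2 ^ n * 2 ^ (n C 2)
  ≡⟨ sym (^-distribˡ-+-* 2 n (n C 2)) ⟩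
    2 ^ (n + n C 2)
  ≡⟨ cong (λ z → 2 ^ (z + n C 2)) (sym (nC1≡n n)) ⟩
    2 ^ (n C 1 + n C 2)
  ≡⟨ cong (2 ^_) (nCk+nC[k+1]≡[n+1]C[k+1] n 1) ⟩
    numGraphs (suc n) ∎
  where open ≡-Reasoning

totalFar-step : ∀ n → 4 * totalFar (suc n) ≡ 8 * totalWeight n + 3 * 2 ^ n * totalFar n
totalFar-step n = begin
    4 * totalFar (suc n)
  ≡⟨ cong (4 *_) (ΣG-step n farPairs) ⟩
    4 * ΣL (λ g → ΣL (λ e → farPairs {suc n} (g , e)) (allVecs n)) (allGraphs n)
  ≡⟨ trans (sym (ΣL-* 4 _ (allGraphs n))) (ΣL-cong (λ g → Extension.Σ-farPairs g) (allGraphs n)) ⟩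
    ΣL (λ g → 8 * weight g + 3 * 2 ^ n * farPairs g) (allGraphs n)
  ≡⟨ trans (ΣL-+ (λ g → 8 * weight g) _ (allGraphs n))
           (cong₂ _+_ (ΣL-* 8 weight (allGraphs n)) (ΣL-* (3 * 2 ^ n) farPairs (allGraphs n))) ⟩
    8 * totalWeight n + 3 * 2 ^ n * totalFar n ∎
  where open ≡-Reasoning

totalWeight-step : ∀ n → 2 * totalWeight (suc n) ≡ 2 * 3 ^ n * total n + 3 * 2 ^ n * totalWeight n
totalWeight-step n = begin
    2 * totalWeight (suc n)
  ≡⟨ cong (2 *_) (ΣG-step n weight) ⟩
    2 * ΣL (λ g → ΣL (λ e → weight {suc n} (g , e)) (allVecs n)) (allGraphs n)
  ≡⟨ trans (sym (ΣL-* 2 _ (allGraphs n))) (ΣL-cong (λ g → Extension.Σ-weight g) (allGraphs n)) ⟩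
    ΣL (λ g → 2 * 3 ^ n + 3 * 2 ^ n * weight g) (allGraphs n)
  ≡⟨ ΣL-+ (λ g → 2 * 3 ^ n) _ (allGraphs n) ⟩
    ΣL (λ g → 2 * 3 ^ n) (allGraphs n) + ΣL (λ g → 3 * 2 ^ n * weight g) (allGraphs n)
  ≡⟨ cong₂ _+_ (trans (ΣL-cong (λ g → sym (*-identityʳ (2 * 3 ^ n))) (allGraphs n))
                      (ΣL-* (2 * 3 ^ n) (λ _ → 1) (allGraphs n)))
               (ΣL-* (3 * 2 ^ n) weight (allGraphs n)) ⟩
    2 * 3 ^ n * total n + 3 * 2 ^ n * totalWeight n ∎
  where open ≡-Reasoning

totalWeight-closed : ∀ n → 3 * 2 ^ n * totalWeight n ≡ 2 * n * 3 ^ n * total n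
totalWeight-closed zero    = refl
totalWeight-closed (suc n) = begin
    3 * (2 * a) * totalWeight (suc n)
  ≡⟨ l1 a (totalWeight (suc n)) ⟩
    3 * a * (2 * totalWeight (suc n))
  ≡⟨ cong (3 * a *_) (totalWeight-step n) ⟩
    3 * a * (2 * b * t + 3 * a * P)
  ≡⟨ l2 a b t (3 * a * P) ⟩
    6 * a * b * t + 3 * a * (3 * a * P)
  ≡⟨ cong (λ z → 6 * a * b * t + 3 * a * z) (totalWeight-closed n) ⟩
    6 * a * b * t + 3 * a * (2 * n * b * t)
  ≡⟨ l3 a b t n ⟩
    2 * suc n * (3 * b) * (a * t)
  ≡⟨ cong (2 * suc n * (3 * b) *_) (sym (total-step n)) ⟩
    2 * suc n * 3 ^ suc n * total (suc n) ∎
  where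
  open ≡-Reasoning
  a = 2 ^ n
  b = 3 ^ n
  t = total n
  P = totalWeight n
  l1 : ∀ a x → 3 * (2 * a) * x ≡ 3 * a * (2 * x)
  l1 = solve-∀
  l2 : ∀ a b t y → 3 * a * (2 * b * t + y) ≡ 6 * a * b * t + 3 * a * y
  l2 = solve-∀
  l3 : ∀ a b t n → 6 * a * b * t + 3 * a * (2 * n * b * t) ≡ 2 * suc n * (3 * b) * (a * t)
  l3 = solve-∀

totalFar-bound : ∀ n → 9 * (2 ^ n * 2 ^ n) * totalFar n ≤ 8 * n * n * 3 ^ n * total n
totalFar-bound zero    = z≤n
totalFar-bound (suc n) = begin
    9 * (2 * a * (2 * a)) * totalFar (suc n)
  ≡⟨ l1 a (totalFar (suc n)) ⟩
    9 * a * a * (4 * totalFar (suc n))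
  ≡⟨ cong (9 * a * a *_) (totalFar-step n) ⟩
    9 * a * a * (8 * P + 3 * a * S)
  ≡⟨ l2 a P S ⟩
    24 * a * (3 * a * P) + 3 * a * (9 * (a * a) * S)
  ≤⟨ +-mono-≤ (≤-reflexive (cong (24 * a *_) (totalWeight-closed n))) (*-monoʳ-≤ (3 * a) (totalFar-bound n)) ⟩
    24 * a * (2 * n * b * t) + 3 * a * (8 * n * n * b * t)
  ≤⟨ m≤m+n _ (24 * a * b * t) ⟩
    24 * a * (2 * n * b * t) + 3 * a * (8 * n * n * b * t) + 24 * a * b * t
  ≡⟨ l3 a b t n ⟩
    8 * suc n * suc n * (3 * b) * (a * t)
  ≡⟨ cong (8 * suc n * suc n * (3 * b) *_) (sym (total-step n)) ⟩
    8 * suc n * suc n * 3 ^ suc n * total (suc n) ∎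
  where
  open ≤-Reasoning
  a = 2 ^ n
  b = 3 ^ n
  t = total n
  P = totalWeight n
  S = totalFar n
  l1 : ∀ a x → 9 * (2 * a * (2 * a)) * x ≡ 9 * a * a * (4 * x)
  l1 = solve-∀
  l2 : ∀ a P S → 9 * a * a * (8 * P + 3 * a * S) ≡ 24 * a * (3 * a * P) + 3 * a * (9 * (a * a) * S)
  l2 = solve-∀
  l3 : ∀ a b t n → 24 * a * (2 * n * b * t) + 3 * a * (8 * n * n * b * t) + 24 * a * b * t
                     ≡ 8 * suc n * suc n * (3 * b) * (a * t)
  l3 = solve-∀

-- n³·3ⁿ ≤ 64·4ⁿ for n ≥ 10: true at n = 10, and 3(n+1)³ ≤ 4n³ from there on.
cubic-vs-exp : ∀ m → (10 + m) * (10 + m) * (10 + m) * 3 ^ (10 + m) ≤ 64 * (2 ^ (10 + m) * 2 ^ (10 + m))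
cubic-vs-exp zero    = toWitness {a? = 1000 * 59049 ≤? 64 * (1024 * 1024)} _
cubic-vs-exp (suc m) = begin
    suc k * suc k * suc k * (3 * b)
  ≡⟨ l1 k b ⟩
    3 * (suc k * suc k * suc k) * b
  ≤⟨ *-monoˡ-≤ b cubic-step ⟩
    4 * (k * k * k) * b
  ≡⟨ *-assoc 4 (k * k * k) b ⟩
    4 * (k * k * k * b)
  ≤⟨ *-monoʳ-≤ 4 (cubic-vs-exp m) ⟩
    4 * (64 * (a * a))
  ≡⟨ l2 a ⟩
    64 * (2 * a * (2 * a)) ∎
  where
  open ≤-Reasoning
  k = 10 + m
  a = 2 ^ k
  b = 3 ^ k
  l1 : ∀ k b → suc k * suc k * suc k * (3 * b) ≡ 3 * (suc k * suc k * suc k) * b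
  l1 = solve-∀
  l2 : ∀ a → 4 * (64 * (a * a)) ≡ 64 * (2 * a * (2 * a))
  l2 = solve-∀
  gap : ∀ m → 3 * (suc (10 + m) * suc (10 + m) * suc (10 + m)) + (m * m * m + 21 * m * m + 111 * m + 7)
                ≡ 4 * ((10 + m) * (10 + m) * (10 + m))
  gap = solve-∀
  cubic-step : 3 * (suc k * suc k * suc k) ≤ 4 * (k * k * k)
  cubic-step = subst (3 * (suc k * suc k * suc k) ≤_) (gap m) (m≤m+n _ _)

totalFar-small : ∀ n → 10 ≤ n → 9 * n * totalFar n ≤ 512 * total n
totalFar-small n 10≤n with m≤n⇒∃[o]m+o≡n 10≤n
... | m , refl = *-cancelʳ-≤ (9 * n * totalFar n) (512 * total n) (a * a) {{4ⁿ≢0}} (begin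
    9 * n * totalFar n * (a * a)
  ≡⟨ l1 n (totalFar n) (a * a) ⟩
    n * (9 * (a * a) * totalFar n)
  ≤⟨ *-monoʳ-≤ n (totalFar-bound n) ⟩
    n * (8 * n * n * 3 ^ n * total n)
  ≡⟨ l2 n (3 ^ n) (total n) ⟩
    8 * total n * (n * n * n * 3 ^ n)
  ≤⟨ *-monoʳ-≤ (8 * total n) (cubic-vs-exp m) ⟩
    8 * total n * (64 * (a * a))
  ≡⟨ l3 (total n) (a * a) ⟩
    512 * total n * (a * a) ∎)
  where
  open ≤-Reasoning
  a = 2 ^ (10 + m)
  4ⁿ≢0 = m*n≢0 a a {{m^n≢0 2 (10 + m)}} {{m^n≢0 2 (10 + m)}}
  l1 : ∀ n S x → 9 * n * S * x ≡ n * (9 * x * S)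
  l1 = solve-∀
  l2 : ∀ n b t → n * (8 * n * n * b * t) ≡ 8 * t * (n * n * n * b)
  l2 = solve-∀
  l3 : ∀ t x → 8 * t * (64 * x) ≡ 512 * t * x
  l3 = solve-∀

-- A multiset of numbers in {0,1,2} is determined by its size and its numbers of
-- 0s and 1s: both lists are permutations of the sorted list 0…0 1…1 2…2.
count : ℕ → List ℕ → ℕ
count r xs = ΣL (λ y → ⟦ y ≡ᵇ r ⟧) xs

sorted012 : ℕ → ℕ → ℕ → List ℕ
sorted012 a b c = replicate a 0 ++ (replicate b 1 ++ replicate c 2)

↭-sorted012 : ∀ xs → All (_≤ 2) xs → xs ↭ sorted012 (count 0 xs) (count 1 xs) (count 2 xs)
↭-sorted012 []       []       = ↭-refl
↭-sorted012 (0 ∷ xs) (_ ∷ ≤2) = prep 0 (↭-sorted012 xs ≤2)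
↭-sorted012 (1 ∷ xs) (_ ∷ ≤2) = ↭-trans (prep 1 (↭-sorted012 xs ≤2))
  (↭-sym (shift 1 (replicate (count 0 xs) 0) _))
↭-sorted012 (2 ∷ xs) (_ ∷ ≤2) = ↭-trans (prep 2 (↭-sorted012 xs ≤2))
  (↭-trans (↭-sym (shift 2 (replicate (count 0 xs) 0) _))
           (++⁺ˡ (replicate (count 0 xs) 0) (↭-sym (shift 2 (replicate (count 1 xs) 1) _))))
↭-sorted012 (suc (suc (suc _)) ∷ xs) (s≤s (s≤s ()) ∷ _)

length-012 : ∀ xs → All (_≤ 2) xs → length xs ≡ count 0 xs + (count 1 xs + count 2 xs)
length-012 []       []       = refl
length-012 (0 ∷ xs) (_ ∷ ≤2) = cong suc (length-012 xs ≤2)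
length-012 (1 ∷ xs) (_ ∷ ≤2) = trans (cong suc (length-012 xs ≤2)) (sym (+-suc (count 0 xs) _))
length-012 (2 ∷ xs) (_ ∷ ≤2) = trans (cong suc (length-012 xs ≤2)) (shuffle (count 0 xs) (count 1 xs) (count 2 xs))
  where shuffle : ∀ a b c → suc (a + (b + c)) ≡ a + (b + suc c)
        shuffle = solve-∀
length-012 (suc (suc (suc _)) ∷ xs) (s≤s (s≤s ()) ∷ _)

↭-by-counts : ∀ xs ys → All (_≤ 2) xs → All (_≤ 2) ys → length xs ≡ length ys →
  count 0 xs ≡ count 0 ys → count 1 xs ≡ count 1 ys → xs ↭ ys
↭-by-counts xs ys ≤2ˣ ≤2ʸ same-length same0 same1 = begin
    xs
  ↭⟨ ↭-sorted012 xs ≤2ˣ ⟩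
    sorted012 (count 0 xs) (count 1 xs) (count 2 xs)
  ≡⟨ cong₃ sorted012 same0 same1 same2 ⟩
    sorted012 (count 0 ys) (count 1 ys) (count 2 ys)
  ↭⟨ ↭-sym (↭-sorted012 ys ≤2ʸ) ⟩
    ys ∎
  where
  open PermutationReasoning
  cong₃ : ∀ (f : ℕ → ℕ → ℕ → List ℕ) {a a′ b b′ c c′} →
    a ≡ a′ → b ≡ b′ → c ≡ c′ → f a b c ≡ f a′ b′ c′
  cong₃ f refl refl refl = refl
  same2 : count 2 xs ≡ count 2 ys
  same2 = +-cancelˡ-≡ (count 1 xs) _ _ (+-cancelˡ-≡ (count 0 xs) _ _ (trans (sym (length-012 xs ≤2ˣ))
    (trans same-length (trans (length-012 ys ≤2ʸ) (cong₂ (λ a b → a + (b + count 2 ys)) (sym same0) (sym same1))))))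

module _ {n : ℕ} where

  count-self : ∀ {W : List (Fin n)} → Unique W → ∀ {x} → x ∈ W → ΣL (λ w → ⟦ eqF x w ⟧) W ≡ 1
  count-self {y ∷ ys} (y∉ys ∷ _) (here refl) rewrite eqF-refl y = cong suc (none ys y∉ys)
    where
    none : ∀ zs → All (y ≢_) zs → ΣL (λ w → ⟦ eqF y w ⟧) zs ≡ 0
    none []       []          = refl
    none (z ∷ zs) (y≢z ∷ y∉zs) with eqF y z in e
    ... | true  = ⊥-elim (y≢z (eqF-true y z e))
    ... | false = none zs y∉zs
  count-self {y ∷ ys} (y∉ys ∷ unique) {x} (there x∈ys) with eqF x y in e
  ... | true  = ⊥-elim (All.lookup y∉ys (subst (_∈ ys) (eqF-true x y e) x∈ys) refl)
  ... | false = count-self unique x∈ys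

  lookup-injective : ∀ {W : List (Fin n)} → Unique W → ∀ i j → List.lookup W i ≡ List.lookup W j → i ≡ j
  lookup-injective (_ ∷ _) zero zero _ = refl
  lookup-injective {y ∷ ys} (y∉ys ∷ _) zero    (suc j) e = ⊥-elim (All.lookup y∉ys (∈-lookup j) e)
  lookup-injective {y ∷ ys} (y∉ys ∷ _) (suc i) zero    e = ⊥-elim (All.lookup y∉ys (∈-lookup i) (sym e))
  lookup-injective (_ ∷ unique) (suc i) (suc j) e = cong suc (lookup-injective unique i j e)

module _ {A : Set} (p : A → Bool) where

  count-miss₁ : ∀ {W x} → x ∈ W → p x ≡ false → suc (ΣL (λ w → ⟦ p w ⟧) W) ≤ length W
  count-miss₁ {y ∷ ys} (here refl) px rewrite px = s≤s (at-most ys)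
    where
    at-most : ∀ zs → ΣL (λ w → ⟦ p w ⟧) zs ≤ length zs
    at-most []       = z≤n
    at-most (z ∷ zs) = +-mono-≤ (⟦⟧≤1 (p z)) (at-most zs)
  count-miss₁ {y ∷ ys} (there x∈ys) px =
    ≤-trans (s≤s (+-monoˡ-≤ (ΣL (λ w → ⟦ p w ⟧) ys) (⟦⟧≤1 (p y)))) (s≤s (count-miss₁ x∈ys px))

  count-miss₂ : ∀ {W x y} → x ∈ W → y ∈ W → x ≢ y → p x ≡ false → p y ≡ false →
    suc (suc (ΣL (λ w → ⟦ p w ⟧) W)) ≤ length W
  count-miss₂ (here refl) (here refl) x≢y _ _ = ⊥-elim (x≢y refl)
  count-miss₂ (here refl) (there y∈) _ px py rewrite px = s≤s (count-miss₁ y∈ py)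
  count-miss₂ (there x∈) (here refl) _ px py rewrite py = s≤s (count-miss₁ x∈ px)
  count-miss₂ {z ∷ zs} (there x∈) (there y∈) x≢y px py =
    ≤-trans (s≤s (s≤s (+-monoˡ-≤ (ΣL (λ w → ⟦ p w ⟧) zs) (⟦⟧≤1 (p z)))))
            (s≤s (count-miss₂ x∈ y∈ x≢y px py))

  count-zero : ∀ {W} → ΣL (λ w → ⟦ p w ⟧) W ≡ 0 → ∀ {y} → y ∈ W → p y ≡ false
  count-zero {z ∷ zs} none (here refl) with p z
  ... | false = refl
  count-zero {z ∷ zs} none (there y∈) = count-zero (m+n≡0⇒n≡0 ⟦ p z ⟧ none) y∈

collision : ∀ k (f : Fin (suc (suc k)) → ℕ) → (∀ i → f i < suc k) →
  ∃ λ i → ∃ λ j → i ≢ j × f i ≡ f j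
collision k f f< with FinP.pigeonhole (n<1+n (suc k)) (λ i → fromℕ< (f< i))
... | i , j , i<j , same = i , j , FinP.<⇒≢ i<j ,
  trans (sym (FinP.toℕ-fromℕ< (f< i))) (trans (cong toℕ same) (FinP.toℕ-fromℕ< (f< j)))

degree-pigeonhole : ∀ k (f : Fin (suc (suc k)) → ℕ) → (∀ i → f i ≤ suc k) →
  (∀ i j → f i ≡ 0 → i ≢ j → f j ≤ k) → ∃ λ i → ∃ λ j → i ≢ j × f i ≡ f j
-- If some value is 0, all values are ≤ k; otherwise the values minus one are.
degree-pigeonhole k f f≤ zero-forces with FinP.any? (λ i → f i ≟ 0)
... | yes (i , fi≡0) = collision k f below
  where
  below : ∀ j → f j < suc k
  below j with j FinP.≟ i
  ... | yes refl = subst (_< suc k) (sym fi≡0) (s≤s z≤n)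
  ... | no j≢i   = s≤s (zero-forces i j fi≡0 (j≢i ∘ sym))
... | no no-zero with collision k (λ j → pred (f j)) (λ j → s≤s (pred-mono-≤ (f≤ j)))
...   | i , j , i≢j , same =
  i , j , i≢j , pred-injective {{≢-nonZero (no-zero ∘ (i ,_))}} {{≢-nonZero (no-zero ∘ (j ,_))}} same

equal-degrees : ∀ {n} (G : Graph n) W → Unique W → 2 ≤ length W →
  ∃ λ u → ∃ λ v → u ≢ v × u ∈ W × v ∈ W ×
    ΣL (λ w → ⟦ adj G u w ⟧) W ≡ ΣL (λ w → ⟦ adj G v w ⟧) W
equal-degrees G []           _ ()
equal-degrees G (_ ∷ [])     _ (s≤s ())
equal-degrees G W@(_ ∷ _ ∷ rest) unique _ with degree-pigeonhole (length rest) deg deg≤ isolated-forces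
  where
  vertex : Fin (length W) → Fin _
  vertex = List.lookup W
  deg : Fin (length W) → ℕ
  deg i = ΣL (λ w → ⟦ adj G (vertex i) w ⟧) W
  -- A vertex is not adjacent to itself, and an isolated one to nobody in W.
  deg≤ : ∀ i → deg i ≤ suc (length rest)
  deg≤ i = ≤-pred (count-miss₁ (adj G (vertex i)) (∈-lookup {xs = W} i) (adj-irrefl G (vertex i)))
  isolated-forces : ∀ i j → deg i ≡ 0 → i ≢ j → deg j ≤ length rest
  isolated-forces i j isolated i≢j = ≤-pred (≤-pred (count-miss₂ (adj G (vertex j))
    (∈-lookup {xs = W} j) (∈-lookup {xs = W} i)
    (i≢j ∘ sym ∘ lookup-injective unique j i) (adj-irrefl G (vertex j))
    (trans (adj-sym G (vertex j) (vertex i)) (count-zero (adj G (vertex i)) isolated (∈-lookup {xs = W} j)))))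
... | i , j , i≢j , same = List.lookup W i , List.lookup W j , i≢j ∘ lookup-injective unique i j ,
  ∈-lookup {xs = W} i , ∈-lookup {xs = W} j , same

walk≥1 : ∀ {n} {G : Graph n} {u w m} → u ≢ w → Walk G u w m → 1 ≤ m
walk≥1 u≢w here       = ⊥-elim (u≢w refl)
walk≥1 _   (step _ _) = s≤s z≤n

walk≥2 : ∀ {n} {G : Graph n} {u w m} → u ≢ w → adj G u w ≡ false → Walk G u w m → 2 ≤ m
walk≥2 u≢w _      here                = ⊥-elim (u≢w refl)
walk≥2 _   nonadj (step u~w here)     with () ← trans (sym u~w) nonadj
walk≥2 _   _      (step _ (step _ _)) = s≤s (s≤s z≤n)

-- The distance in a graph of diameter ≤ 2, computed from equality and adjacency.
level : (same adjacent : Bool) → ℕ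
level true  _     = 0
level false true  = 1
level false false = 2

level≤2 : ∀ p q → level p q ≤ 2
level≤2 true  _     = z≤n
level≤2 false true  = s≤s z≤n
level≤2 false false = s≤s (s≤s z≤n)

-- Entries 0 of a distance profile come from W-entries equal to the vertex, entries 1
-- from its neighbours (adjacency being loopless).
level≡0 : ∀ p q → ⟦ level p q ≡ᵇ 0 ⟧ ≡ ⟦ p ⟧
level≡0 true  _     = refl
level≡0 false true  = refl
level≡0 false false = refl

level≡1 : ∀ p q → (p ≡ true → q ≡ false) → ⟦ level p q ≡ᵇ 1 ⟧ ≡ ⟦ q ⟧
level≡1 true  q     loopless rewrite loopless refl = refl
level≡1 false true  _ = refl
level≡1 false false _ = refl

NoFarPair : ∀ {n} → Graph n → Set
NoFarPair G = ∀ i j → far G i j ≡ false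

farPairs≡0 : ∀ {n} (G : Graph n) → farPairs G ≡ 0 → NoFarPair G
farPairs≡0 G none i j = ⟦⟧≡0 (ΣF-zero _ (ΣF-zero (λ i → ΣF (λ j → ⟦ far G i j ⟧)) none i) j)
  where
  ⟦⟧≡0 : ∀ {b} → ⟦ b ⟧ ≡ 0 → b ≡ false
  ⟦⟧≡0 {false} _ = refl

module DiameterTwo {n} (G : Graph n) (noFar : NoFarPair G) where

  distinct : ∀ {u w : Fin n} → eqF u w ≡ false → u ≢ w
  distinct {u} different refl with () ← trans (sym (eqF-refl u)) different

  common : ∀ u w → eqF u w ≡ false → adj G u w ≡ false → commonNbr G u w ≡ true
  common u w different nonadj = not-injective
    (trans (sym (cong₂ (λ a b → not a ∧ (not b ∧ not (commonNbr G u w))) different nonadj)) (noFar u w))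

  dist : Fin n → Fin n → ℕ
  dist u w = level (eqF u w) (adj G u w)

  distance : ∀ u w → Dist G u w (dist u w)
  distance u w with eqF u w in same | adj G u w in adjacent
  ... | true  | _ with eqF-true u w same
  ...   | refl = here , λ _ _ → z≤n
  distance u w | false | true  = step adjacent here , λ _ → walk≥1 (distinct same)
  distance u w | false | false with anyF-true (λ x → adj G u x ∧ adj G x w) (common u w same adjacent)
  ...   | x , u~x~w = step (first u~x~w) (step (second u~x~w) here) , λ _ → walk≥2 (distinct same) adjacent
    where
    first : ∀ {a b} → a ∧ b ≡ true → a ≡ true
    first {true} _ = refl
    second : ∀ {a b} → a ∧ b ≡ true → b ≡ true
    second {true} e = e

  connected : Connected G
  connected u v = dist u v , proj₁ (distance u v)

  distances : ∀ v W → RM G v W (map (dist v) W)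
  distances v []      = []
  distances v (w ∷ W) = distance v w ∷ distances v W

  same-counts⇒↭ : ∀ u v W →
    ΣL (λ w → ⟦ eqF u w ⟧) W ≡ ΣL (λ w → ⟦ eqF v w ⟧) W →
    ΣL (λ w → ⟦ adj G u w ⟧) W ≡ ΣL (λ w → ⟦ adj G v w ⟧) W →
    map (dist u) W ↭ map (dist v) W
  same-counts⇒↭ u v W same0 same1 = ↭-by-counts _ _ (≤2 u) (≤2 v)
    (trans (length-map (dist u) W) (sym (length-map (dist v) W)))
    (trans (zeros u) (trans same0 (sym (zeros v))))
    (trans (ones u) (trans same1 (sym (ones v))))
    where
    ≤2 : ∀ x → All (_≤ 2) (map (dist x) W)
    ≤2 x = map⁺ (All.tabulate (λ {w} _ → level≤2 (eqF x w) (adj G x w)))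
    zeros : ∀ x → count 0 (map (dist x) W) ≡ ΣL (λ w → ⟦ eqF x w ⟧) W
    zeros x = trans (ΣL-map _ (dist x) W) (ΣL-cong (λ w → level≡0 (eqF x w) (adj G x w)) W)
    ones : ∀ x → count 1 (map (dist x) W) ≡ ΣL (λ w → ⟦ adj G x w ⟧) W
    ones x = trans (ΣL-map _ (dist x) W) (ΣL-cong (λ w → level≡1 (eqF x w) (adj G x w)
      (λ same → subst (λ z → adj G x z ≡ false) (eqF-true x w same) (adj-irrefl G x))) W)

  Twins : List (Fin n) → Set
  Twins W = ∃ λ u → ∃ λ v → u ≢ v × ΣL (λ w → ⟦ eqF u w ⟧) W ≡ ΣL (λ w → ⟦ eqF v w ⟧) W ×
                                    ΣL (λ w → ⟦ adj G u w ⟧) W ≡ ΣL (λ w → ⟦ adj G v w ⟧) W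

  twins⇒¬resolving : ∀ W → Twins W → ¬ MResolving G W
  twins⇒¬resolving W (u , v , u≢v , same0 , same1) resolving =
    resolving u v u≢v _ _ (distances u W) (distances v W) (same-counts⇒↭ u v W same0 same1)

  single : ∀ {a b} → a ≡ b → ⟦ a ⟧ + 0 ≡ ⟦ b ⟧ + 0
  single = cong (λ b → ⟦ b ⟧ + 0)

  twins-outside : ∀ w (x y z : Fin n) → x ≢ y → x ≢ z → y ≢ z →
    eqF x w ≡ false → eqF y w ≡ false → eqF z w ≡ false → Twins (w ∷ [])
  twins-outside w x y z x≢y x≢z y≢z x≠w y≠w z≠w with adj G x w in xw | adj G y w in yw | adj G z w in zw
  ... | true  | true  | _     = x , y , x≢y , single (trans x≠w (sym y≠w)) , single (trans xw (sym yw))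
  ... | false | false | _     = x , y , x≢y , single (trans x≠w (sym y≠w)) , single (trans xw (sym yw))
  ... | true  | false | true  = x , z , x≢z , single (trans x≠w (sym z≠w)) , single (trans xw (sym zw))
  ... | false | true  | false = x , z , x≢z , single (trans x≠w (sym z≠w)) , single (trans xw (sym zw))
  ... | true  | false | false = y , z , y≢z , single (trans y≠w (sym z≠w)) , single (trans yw (sym zw))
  ... | false | true  | true  = y , z , y≢z , single (trans y≠w (sym z≠w)) , single (trans yw (sym zw))

  twins-many : ∀ W → Unique W → 2 ≤ length W → Twins W
  twins-many W unique 2≤|W| with equal-degrees G W unique 2≤|W|
  ... | u , v , u≢v , u∈W , v∈W , same =
    u , v , u≢v , trans (count-self unique u∈W) (sym (count-self unique v∈W)) , same

noFarPair⇒mdInfinite : ∀ {n} (G : Graph n) → 4 ≤ n → NoFarPair G → MdInfinite G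
noFarPair⇒mdInfinite {suc (suc (suc (suc m)))} G (s≤s (s≤s (s≤s (s≤s _)))) noFar W unique =
  twins⇒¬resolving W (twins W unique)
  where
  open DiameterTwo G noFar
  v₀ v₁ v₂ v₃ : Fin (4 + m)
  v₀ = zero
  v₁ = suc zero
  v₂ = suc (suc zero)
  v₃ = suc (suc (suc zero))
  -- W = ∅: any two vertices; |W| = 1: three vertices outside W; |W| ≥ 2: degrees.
  twins : ∀ W → Unique W → Twins W
  twins []                           _ = v₀ , v₁ , (λ ()) , refl , refl
  twins (w@zero ∷ [])                _ = twins-outside w v₁ v₂ v₃ (λ ()) (λ ()) (λ ()) refl refl refl
  twins (w@(suc zero) ∷ [])          _ = twins-outside w v₀ v₂ v₃ (λ ()) (λ ()) (λ ()) refl refl refl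
  twins (w@(suc (suc zero)) ∷ [])    _ = twins-outside w v₀ v₁ v₃ (λ ()) (λ ()) (λ ()) refl refl refl
  twins (w@(suc (suc (suc _))) ∷ []) _ = twins-outside w v₀ v₁ v₂ (λ ()) (λ ()) (λ ()) refl refl refl
  twins W@(_ ∷ _ ∷ _) unique = twins-many W unique (s≤s (s≤s z≤n))

hasNoFar : ∀ {n} → Graph n → Bool
hasNoFar G = farPairs G ≡ᵇ 0

diameterTwoGraphs : ∀ n → List (Graph n)
diameterTwoGraphs n = filter (T? ∘ hasNoFar) (allGraphs n)

-- Markov's inequality: a graph left out of the filter has at least one far pair.
markov : ∀ {n} (gs : List (Graph n)) → ΣL (λ _ → 1) gs ≤ length (filter (T? ∘ hasNoFar) gs) + ΣL farPairs gs
markov []       = z≤n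
markov (g ∷ gs) with farPairs g
... | zero  = s≤s (markov gs)
... | suc f = begin
    suc (ΣL (λ _ → 1) gs)
  ≤⟨ s≤s (markov gs) ⟩
    suc (L + S)
  ≤⟨ s≤s (+-monoʳ-≤ L (m≤n+m S f)) ⟩
    suc (L + (f + S))
  ≡⟨ sym (+-suc L (f + S)) ⟩
    L + suc (f + S) ∎
  where
  open ≤-Reasoning
  L = length (filter (T? ∘ hasNoFar) gs)
  S = ΣL farPairs gs

few-far-pairs : ∀ k n → 57 * suc k + 10 ≤ n → suc k * totalFar n ≤ total n
few-far-pairs k n N≤n = *-cancelˡ-≤ 512 (begin
    512 * (suc k * totalFar n)
  ≡⟨ sym (*-assoc 512 (suc k) (totalFar n)) ⟩
    512 * suc k * totalFar n
  ≤⟨ *-monoˡ-≤ (totalFar n) 512[k+1]≤9n ⟩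
    9 * n * totalFar n
  ≤⟨ totalFar-small n (≤-trans (m≤n+m 10 (57 * suc k)) N≤n) ⟩
    512 * total n ∎)
  where
  open ≤-Reasoning
  512[k+1]≤9n : 512 * suc k ≤ 9 * n
  512[k+1]≤9n = begin
      512 * suc k   ≤⟨ *-monoˡ-≤ (suc k) (n≤1+n 512) ⟩
      9 * 57 * suc k ≡⟨ *-assoc 9 57 (suc k) ⟩
      9 * (57 * suc k) ≤⟨ *-monoʳ-≤ 9 (≤-trans (m≤m+n (57 * suc k) 10) N≤n) ⟩
      9 * n ∎

most-graphs-diameterTwo : ∀ k n → 57 * suc k + 10 ≤ n → k * numGraphs n ≤ suc k * length (diameterTwoGraphs n)
most-graphs-diameterTwo k n N≤n = subst (λ t → k * t ≤ suc k * L) (total≡numGraphs n)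
  (+-cancelʳ-≤ (total n) (k * total n) (suc k * L) (begin
    k * total n + total n
  ≡⟨ +-comm (k * total n) (total n) ⟩
    suc k * total n
  ≤⟨ *-monoʳ-≤ (suc k) (markov (allGraphs n)) ⟩
    suc k * (L + totalFar n)
  ≡⟨ *-distribˡ-+ (suc k) L (totalFar n) ⟩
    suc k * L + suc k * totalFar n
  ≤⟨ +-monoʳ-≤ (suc k * L) (few-far-pairs k n N≤n) ⟩
    suc k * L + total n ∎))
  where
  open ≤-Reasoning
  L = length (diameterTwoGraphs n)

diameterTwo-qualifies : ∀ {n} → 4 ≤ n → (G : Graph n) → T (hasNoFar G) → Connected G × MdInfinite G
diameterTwo-qualifies 4≤n G listed = DiameterTwo.connected G noFar , noFarPair⇒mdInfinite G 4≤n noFar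
  where noFar = farPairs≡0 G (≡ᵇ⇒≡ (farPairs G) 0 listed)

corollary3p3 : ∀ (k : ℕ) → ∃ λ (N : ℕ) → ∀ (n : ℕ) → N ≤ n →
    Σ (List (Graph n)) λ L →
      Unique L × All (λ G → Connected G × MdInfinite G) L ×
      k * numGraphs n ≤ suc k * length L
corollary3p3 k = 57 * suc k + 10 , λ n N≤n →
  diameterTwoGraphs n ,
  filter⁺ (T? ∘ hasNoFar) (allGraphs-unique n) ,
  All.map (diameterTwo-qualifies (≤-trans 4≤N N≤n) _) (all-filter (T? ∘ hasNoFar) (allGraphs n)) ,
  most-graphs-diameterTwo k n N≤n
  where
  4≤N : 4 ≤ 57 * suc k + 10
  4≤N = ≤-trans (s≤s (s≤s (s≤s (s≤s z≤n)))) (m≤n+m 10 (57 * suc k))
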